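{- For any integers $n,m\geq1$, there is an isomorphism of ranked posets $\psi_{n,m}:\mathcal{N}(n,m)\simeq\mathcal{Q}(mn,m)$.
   Context: $\mathcal{N}(n,m)$ is the set of $n$-bead $(m{+}1)$-ary necklaces (orbits of $\{0,1,\dots,m\}^n$ under cyclic rotation by $\mathbb{Z}_n$) with $[0,\dots,0]$ and $[m,\dots,m]$ removed, ordered by $[x]\leq[y]$ iff some rotations $x',y'$ satisfy $x'\leq y'$ componentwise, and ranked by the sum of the entries. For $N\geq1$, $\mathcal{Q}(N)$ is the set of partition necklaces $[a_1,\dots,a_r]$, i.e. $\mathbb{Z}_r$-orbits (under cyclic rotation) of tuples $(a_1,\dots,a_r)$ of positive integers with $\sum a_i=N$ and $1\leq r\leq N-1$; it is ranked by the number of parts $r$ and partially ordered by cyclic refinement: $[a]\leq[b]$ iff some rotation of $b$ is obtained from some rotation of $a$ by splitting each part into an ordered sequence of positive parts with the same sum. A partition necklace is fundamental if all its parts are $\geq2$; $\mathcal{F}(N)$ denotes the set of fundamental necklaces in $\mathcal{Q}(N)$. Every element of $\mathcal{Q}(N)$ has a representative of the form $(1^{n_1},m_1,1^{n_2},m_2,\dots,1^{n_k},m_k)$ with $n_i\geq0$, $m_i\geq2$ ($1^{c}$ meaning $c$ consecutive ones), and the map $\pi_N:\mathcal{Q}(N)\to\mathcal{F}(N)$, $[1^{n_1},m_1,\dots,1^{n_k},m_k]\mapsto[m_1+n_1,\dots,m_k+n_k]$, is well defined. A fundamental necklace is divisible by $m$ if each of its parts is divisible by $m$. Then $\mathcal{Q}(N,m)=\{\alpha\in\mathcal{Q}(N):\pi_N(\alpha)\text{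 is divisible by }m\}$, with the ranked subposet structure from $\mathcal{Q}(N)$. -}

module Defs where

open import Data.Nat using (ℕ; zero; suc; _+_; _*_; _∸_; _≤_)
open import Data.Nat.Divisibility using (_∣_)
open import Data.List using (List; []; _∷_; _∷ʳ_; length; map; concat)
open import Data.Nat.ListAction using (sum)
open import Data.List.Relation.Unary.All as LAll using ()
open import Data.Vec using (Vec; []; _∷_)
import Data.Vec as V
open import Data.Vec.Relation.Unary.All as VAll using ()
open import Data.Vec.Relation.Binary.Pointwise.Inductive using (Pointwise)
open import Data.Product using (Σ; ∃; _×_; _,_; proj₁)
open import Relation.Binary.PropositionalEquality using (_≡_; _≢_)
open import Relation.Nullary using (¬_)
open import Function.Bundles using (_⇔_)

rotV1 : {A : Set} {n : ℕ} → Vec A n → Vec A n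
rotV1 []       = []
rotV1 (x ∷ xs) = xs V.∷ʳ x

rotV : {A : Set} {n : ℕ} → ℕ → Vec A n → Vec A n
rotV zero    x = x
rotV (suc k) x = rotV k (rotV1 x)

rotL1 : {A : Set} → List A → List A
rotL1 []       = []
rotL1 (x ∷ xs) = xs ∷ʳ x

rotL : {A : Set} → ℕ → List A → List A
rotL zero    x = x
rotL (suc k) x = rotL k (rotL1 x)

-- 𝒩(n,m): representatives are words in {0,…,m}^n, not constantly 0,
-- not constantly m.  Elements of 𝒩(n,m) are rotation classes.

NRep : ℕ → ℕ → Set
NRep n m = Σ (Vec ℕ n) λ x →
  VAll.All (_≤ m) x × ¬ VAll.All (_≡ 0) x × ¬ VAll.All (_≡ m) x

_∼N_ : {n m : ℕ} → NRep n m → NRep n m → Set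
x ∼N y = ∃ λ k → rotV k (proj₁ x) ≡ proj₁ y

_≤N_ : {n m : ℕ} → NRep n m → NRep n m → Set
x ≤N y = ∃ λ k → ∃ λ l → Pointwise _≤_ (rotV k (proj₁ x)) (rotV l (proj₁ y))

rankN : {n m : ℕ} → NRep n m → ℕ
rankN x = V.sum (proj₁ x)

Refines : List ℕ → List ℕ → Set
Refines a b = ∃ λ (blocks : List (List ℕ)) →
  LAll.All (λ bl → bl ≢ []) blocks × map sum blocks ≡ a × concat blocks ≡ b

-- π_N on a representative: every maximal run of ones is absorbed into
-- the next (cyclically) part ≥ 2.
-- πgo returns the list of absorbed parts and the number of trailing ones.
πgo : List ℕ → ℕ → List ℕ × ℕ
πgo []            acc = [] , acc
πgo (1 ∷ xs)      acc = πgo xs (suc acc)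
πgo (a ∷ xs)      acc with πgo xs 0
... | ys , t = (a + acc) ∷ ys , t

πN : List ℕ → List ℕ
πN xs with πgo xs 0
... | []      , t = []
... | (y ∷ ys) , t = (y + t) ∷ ys

DivisibleBy : ℕ → List ℕ → Set
DivisibleBy m f = LAll.All (m ∣_) f

IsQ : ℕ → List ℕ → Set
IsQ N a = LAll.All (1 ≤_) a × sum a ≡ N × 1 ≤ length a × length a ≤ N ∸ 1

QRep : ℕ → ℕ → Set
QRep N m = Σ (List ℕ) λ a → IsQ N a × DivisibleBy m (πN a)

_∼Q_ : {N m : ℕ} → QRep N m → QRep N m → Set
a ∼Q b = ∃ λ k → rotL k (proj₁ a) ≡ proj₁ b

_≤Q_ : {N m : ℕ} → QRep N m → QRep N m → Set
a ≤Q b = ∃ λ k → ∃ λ l → Refines (rotL k (proj₁ a)) (rotL l (proj₁ b))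

rankQ : {N m : ℕ} → QRep N m → ℕ
rankQ a = length (proj₁ a)

-- An isomorphism of ranked posets 𝒩(n,m) ≃ 𝒬(N,m), given on
-- representatives: a map compatible with the rotation equivalences
-- inducing a bijection of the quotients, preserving and reflecting the
-- order, and preserving rank.

record IsRankedIso {n m N : ℕ} (ψ : NRep n m → QRep N m) : Set where
  field
    wellDefined : ∀ x y → x ∼N y → ψ x ∼Q ψ y
    injective   : ∀ x y → ψ x ∼Q ψ y → x ∼N y
    surjective  : ∀ b → ∃ λ x → ψ x ∼Q b
    orderIso    : ∀ x y → (x ≤N y) ⇔ (ψ x ≤Q ψ y)
    rankPres    : ∀ x → rankQ (ψ x) ≡ rankN x

-- Both sides are encoded as binary words of length N = mn, up to rotation.
-- * A composition (a₁,…,a_r) of N has the composition word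
--   1 0^(a₁-1) … 1 0^(a_r-1): it has r ones, determines the composition,
--   turns cyclic refinement into componentwise ≤ of rotated words, and the
--   rotations of the composition are the rotations of its word starting
--   with a one.
-- * A vector x ∈ {0,…,m}ⁿ has the block word 1^(x₁) 0^(m-x₁) … : it has Σxᵢ
--   ones, is monotone, turns rotation by k into rotation by km, and (shift
--   lemma) lying below an arbitrary rotation of another block word forces x
--   to lie below a rotation of the other vector.
-- ψ(x) is the composition whose word is the block word of a rotation of x
-- starting with a positive entry and ending with an entry < m.  Cut into
-- maximal runs 1^(a+1) 0^b, this word gives runs 1^a (b+1) of the
-- composition; π sends them to the run lengths, which are multiples of m
-- exactly when runs are unions of blocks.  So ψ(x) ∈ 𝒬(mn,m), and reading
-- runs back as blocks shows ψ is onto.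
module Submission where

open import Defs
open import Data.Nat hiding (_≤ᵇ_)
open import Data.Nat.Properties
open import Data.Nat.ListAction using (sum)
open import Data.Nat.ListAction.Properties using (sum-++)
open import Data.Nat.Divisibility using (_∣_; divides; _∣0; ∣m∣n⇒∣m+n; ∣-refl)
open import Data.Nat.DivMod using (_/_; _%_; m≡m%n+[m/n]*n; m%n<n)
open import Data.Bool using (Bool; true; false) renaming (_≤_ to _⊑_)
open import Data.Bool.Base using (f≤t; b≤b)
open import Data.Bool.Properties using (≤-minimum) renaming (≤-refl to ⊑-refl)
open import Data.List using (List; []; _∷_; _++_; length; replicate; concat; map; take; drop; [_])
open import Data.List.Properties using (++-assoc; ++-identityʳ; length-++; length-replicate; take++drop≡id; length-take; length-drop; ∷-injective)
open import Data.List.Relation.Binary.Pointwise as PW using (Pointwise; []; _∷_)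
open import Data.List.Relation.Unary.All as All using (All; []; _∷_)
open import Data.List.Relation.Unary.All.Properties using () renaming (++⁺ to All-++⁺; ++⁻ to All-++⁻)
open import Data.List.Relation.Unary.All.Properties using (¬Any⇒All¬)
open import Data.List.Relation.Unary.Any using (Any; here; there; any?)
open import Data.List.Relation.Unary.Any.Properties using () renaming (++⁺ˡ to Any-++⁺ˡ; ++⁺ʳ to Any-++⁺ʳ)
open import Data.Vec as V using (Vec; toList)
import Data.Vec.Properties as VP
import Data.Vec.Relation.Binary.Pointwise.Inductive as VPW
import Data.Vec.Relation.Unary.All as VAll
open import Data.Vec.Relation.Unary.All.Properties using (toList⁺; toList⁻)
open import Data.Product using (Σ; ∃; _×_; _,_; proj₁; proj₂)
open import Data.Sum using (_⊎_; inj₁; inj₂)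
open import Data.Empty using (⊥; ⊥-elim)
open import Relation.Nullary using (¬_; yes; no)
open import Relation.Nullary.Decidable using (_×-dec_)
open import Relation.Binary.Definitions using (tri<; tri≈; tri>)
open import Relation.Binary.PropositionalEquality hiding ([_])
open ≡-Reasoning
open import Function.Bundles using (mk⇔)

rotL-[] : {A : Set} (k : ℕ) → rotL {A} k [] ≡ []
rotL-[] zero = refl
rotL-[] (suc k) = rotL-[] k

rotL-+ : {A : Set} (a b : ℕ) (w : List A) → rotL (a + b) w ≡ rotL b (rotL a w)
rotL-+ zero b w = refl
rotL-+ (suc a) b w = rotL-+ a b (rotL1 w)

length-rotL : {A : Set} (k : ℕ) (w : List A) → length (rotL k w) ≡ length w
length-rotL zero w = refl
length-rotL (suc k) [] = length-rotL k []
length-rotL (suc k) (a ∷ w) = trans (length-rotL k (w ++ [ a ])) (trans (length-++ w) (+-comm (length w) 1))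

rotL-++ : {A : Set} (p q : List A) → rotL (length p) (p ++ q) ≡ q ++ p
rotL-++ [] q = sym (++-identityʳ q)
rotL-++ (a ∷ p) q = begin
  rotL (length p) ((p ++ q) ++ [ a ])  ≡⟨ cong (rotL (length p)) (++-assoc p q [ a ]) ⟩
  rotL (length p) (p ++ (q ++ [ a ])) ≡⟨ rotL-++ p (q ++ [ a ]) ⟩
  (q ++ [ a ]) ++ p                   ≡⟨ ++-assoc q [ a ] p ⟩
  q ++ a ∷ p                          ∎

rotL-drop : {A : Set} (k : ℕ) (p q : List A) → k ≤ length p →
  rotL k (p ++ q) ≡ drop k p ++ q ++ take k p
rotL-drop zero p q _ = sym (cong (p ++_) (++-identityʳ q))
rotL-drop (suc k) (a ∷ p) q (s≤s h) = begin
  rotL k ((p ++ q) ++ [ a ])           ≡⟨ cong (rotL k) (++-assoc p q [ a ]) ⟩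
  rotL k (p ++ (q ++ [ a ]))           ≡⟨ rotL-drop k p (q ++ [ a ]) h ⟩
  drop k p ++ (q ++ [ a ]) ++ take k p ≡⟨ cong (drop k p ++_) (++-assoc q [ a ] (take k p)) ⟩
  drop k p ++ q ++ a ∷ take k p        ∎

rotL-undo : {A : Set} (t : ℕ) (w : List A) → ∃ λ i → rotL i (rotL t w) ≡ w
rotL-undo t [] = 0 , rotL-[] t
rotL-undo t (a ∷ w) = t * length w , (begin
  rotL (t * length w) (rotL t (a ∷ w)) ≡⟨ sym (rotL-+ t (t * length w) (a ∷ w)) ⟩
  rotL (t + t * length w) (a ∷ w)      ≡⟨ cong (λ z → rotL z (a ∷ w)) (sym (*-suc t (length w))) ⟩
  rotL (t * length (a ∷ w)) (a ∷ w)    ≡⟨ fullTurns t (a ∷ w) ⟩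
  a ∷ w                                ∎)
  where
    fullTurns : ∀ t w → rotL (t * length w) w ≡ w
    fullTurns zero w = refl
    fullTurns (suc t) w = begin
      rotL (length w + t * length w) w       ≡⟨ rotL-+ (length w) (t * length w) w ⟩
      rotL (t * length w) (rotL (length w) w) ≡⟨ cong (rotL (t * length w)) (trans (cong (rotL (length w)) (sym (++-identityʳ w))) (rotL-++ w [])) ⟩
      rotL (t * length w) w                   ≡⟨ fullTurns t w ⟩
      w                                       ∎

rotL-sym : {A : Set} (t : ℕ) (w w' : List A) → rotL t w ≡ w' → ∃ λ i → rotL i w' ≡ w
rotL-sym t w w' eq with rotL-undo t w
... | i , e = i , trans (cong (rotL i) (sym eq)) e

module _ {A B : Set} {R : A → B → Set} where
  Pointwise-rotL : ∀ k {u v} → Pointwise R u v → Pointwise R (rotL k u) (rotL k v)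
  Pointwise-rotL zero p = p
  Pointwise-rotL (suc k) [] = Pointwise-rotL k []
  Pointwise-rotL (suc k) (r ∷ rs) = Pointwise-rotL k (PW.++⁺ rs (r ∷ []))

module _ {A : Set} {P : A → Set} where
  All-rotL : ∀ k {x} → All P x → All P (rotL k x)
  All-rotL zero p = p
  All-rotL (suc k) [] = All-rotL k []
  All-rotL (suc k) (p ∷ ps) = All-rotL k (All-++⁺ ps (p ∷ []))

  Any-rotL : ∀ k {x} → Any P x → Any P (rotL k x)
  Any-rotL zero p = p
  Any-rotL (suc k) {a ∷ xs} (here p) = Any-rotL k (Any-++⁺ʳ xs (here p))
  Any-rotL (suc k) {a ∷ xs} (there q) = Any-rotL k (Any-++⁺ˡ q)

sum-rotL : ∀ k x → sum (rotL k x) ≡ sum x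
sum-rotL zero x = refl
sum-rotL (suc k) [] = sum-rotL k []
sum-rotL (suc k) (a ∷ xs) = trans (sum-rotL k (xs ++ [ a ]))
  (trans (sum-++ xs [ a ]) (trans (cong (sum xs +_) (+-identityʳ a)) (+-comm (sum xs) a)))

Pointwise-++⁻ : {A B : Set} {R : A → B → Set} (p : List A) (p' : List B) {q : List A} {q' : List B} →
  length p ≡ length p' → Pointwise R (p ++ q) (p' ++ q') → Pointwise R p p' × Pointwise R q q'
Pointwise-++⁻ [] [] _ h = [] , h
Pointwise-++⁻ (a ∷ p) (b ∷ p') e (r ∷ h) with Pointwise-++⁻ p p' (cong pred e) h
... | h1 , h2 = (r ∷ h1) , h2

replicate-+ : {A : Set} (a b : ℕ) (x : A) → replicate (a + b) x ≡ replicate a x ++ replicate b x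
replicate-+ zero b x = refl
replicate-+ (suc a) b x = cong (x ∷_) (replicate-+ a b x)

replicate-snoc : {A : Set} (a : ℕ) (x : A) (X : List A) → replicate a x ++ x ∷ X ≡ x ∷ replicate a x ++ X
replicate-snoc zero x X = refl
replicate-snoc (suc a) x X = cong (x ∷_) (replicate-snoc a x X)

infix 4 _≼_
_≼_ : List Bool → List Bool → Set
_≼_ = Pointwise _⊑_

≼-refl : ∀ {u} → u ≼ u
≼-refl = PW.refl ⊑-refl

falses≼ : ∀ k (v : List Bool) → length v ≡ k → replicate k false ≼ v
falses≼ zero [] _ = []
falses≼ (suc k) (b ∷ v) e = ≤-minimum b ∷ falses≼ k v (cong pred e)

Positive : List ℕ → Set
Positive = All (1 ≤_)

partWord : ℕ → List Bool
partWord a = true ∷ replicate (a ∸ 1) false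

compWord : List ℕ → List Bool
compWord [] = []
compWord (a ∷ as) = partWord a ++ compWord as

compWord-++ : (p q : List ℕ) → compWord (p ++ q) ≡ compWord p ++ compWord q
compWord-++ [] q = refl
compWord-++ (a ∷ p) q = trans (cong (partWord a ++_) (compWord-++ p q))
  (sym (++-assoc (partWord a) (compWord p) (compWord q)))

length-partWord : ∀ {a} → 1 ≤ a → length (partWord a) ≡ a
length-partWord {suc a} _ = cong suc (length-replicate a)

length-compWord : ∀ {a} → Positive a → length (compWord a) ≡ sum a
length-compWord [] = refl
length-compWord {x ∷ xs} (p ∷ ps) =
  trans (length-++ (partWord x)) (cong₂ _+_ (length-partWord p) (length-compWord ps))

compWord-rotL1 : ∀ a as → 1 ≤ a → compWord (as ++ [ a ]) ≡ rotL a (compWord (a ∷ as))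
compWord-rotL1 a as h = begin
  compWord (as ++ [ a ])                 ≡⟨ compWord-++ as [ a ] ⟩
  compWord as ++ partWord a ++ []        ≡⟨ cong (compWord as ++_) (++-identityʳ (partWord a)) ⟩
  compWord as ++ partWord a              ≡⟨ sym (rotL-++ (partWord a) (compWord as)) ⟩
  rotL (length (partWord a)) (compWord (a ∷ as)) ≡⟨ cong (λ z → rotL z (compWord (a ∷ as))) (length-partWord h) ⟩
  rotL a (compWord (a ∷ as))             ∎

compWord-rotL : ∀ k {a} → Positive a → ∃ λ t → compWord (rotL k a) ≡ rotL t (compWord a)
compWord-rotL zero p = 0 , refl
compWord-rotL (suc k) {[]} p = 0 , cong compWord (rotL-[] k)
compWord-rotL (suc k) {x ∷ xs} (h ∷ p) with compWord-rotL k (All-rotL 1 (h ∷ p))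
... | t , e = x + t , (begin
  compWord (rotL k (xs ++ [ x ]))      ≡⟨ e ⟩
  rotL t (compWord (xs ++ [ x ]))      ≡⟨ cong (rotL t) (compWord-rotL1 x xs h) ⟩
  rotL t (rotL x (compWord (x ∷ xs)))  ≡⟨ sym (rotL-+ x t _) ⟩
  rotL (x + t) (compWord (x ∷ xs))     ∎)

drop-replicate : ∀ {A : Set} (t a : ℕ) (x : A) → t < a → ∃ λ r → drop t (replicate a x) ≡ x ∷ r
drop-replicate zero (suc a) x _ = replicate a x , refl
drop-replicate (suc t) (suc a) x (s≤s h) = drop-replicate t a x h

compWord-rotL-inside : ∀ t x as → 1 ≤ x → suc t < x → ∃ λ s → rotL (suc t) (compWord (x ∷ as)) ≡ false ∷ s
compWord-rotL-inside t (suc x) as h (s≤s t<x) with drop-replicate t x false t<x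
... | r , dr = r ++ compWord as ++ take (suc t) (partWord (suc x)) , (begin
  rotL (suc t) (partWord (suc x) ++ compWord as)
    ≡⟨ rotL-drop (suc t) (partWord (suc x)) (compWord as) (≤-trans (<⇒≤ (s≤s t<x)) (≤-reflexive (sym (length-partWord h)))) ⟩
  drop t (replicate x false) ++ compWord as ++ take (suc t) (partWord (suc x))
    ≡⟨ cong (_++ compWord as ++ take (suc t) (partWord (suc x))) dr ⟩
  false ∷ r ++ compWord as ++ take (suc t) (partWord (suc x)) ∎)

compWord-rotL-past : ∀ t x as → 1 ≤ x → x ≤ t → rotL t (compWord (x ∷ as)) ≡ rotL (t ∸ x) (compWord (as ++ [ x ]))
compWord-rotL-past t x as h x≤t = begin
  rotL t (compWord (x ∷ as))                ≡⟨ cong (λ z → rotL z (compWord (x ∷ as))) (sym (m+[n∸m]≡n x≤t)) ⟩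
  rotL (x + (t ∸ x)) (compWord (x ∷ as))    ≡⟨ rotL-+ x (t ∸ x) _ ⟩
  rotL (t ∸ x) (rotL x (compWord (x ∷ as))) ≡⟨ cong (rotL (t ∸ x)) (sym (compWord-rotL1 x as h)) ⟩
  rotL (t ∸ x) (compWord (as ++ [ x ]))     ∎

compWord-rotL-atOne : ∀ t {a} → Positive a → ∀ s → rotL t (compWord a) ≡ true ∷ s →
  ∃ λ k → rotL t (compWord a) ≡ compWord (rotL k a)
compWord-rotL-atOne t = go (suc t) t ≤-refl
  where
  go : ∀ fuel t {a} → t < fuel → Positive a → ∀ s → rotL t (compWord a) ≡ true ∷ s →
    ∃ λ k → rotL t (compWord a) ≡ compWord (rotL k a)
  go _ t {[]} _ _ s e with trans (sym e) (rotL-[] t)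
  ... | ()
  go _ zero {x ∷ as} _ _ s e = 0 , refl
  go (suc fuel) (suc t) {x ∷ as} (s≤s t<fuel) (h ∷ p) s e with x ≤? suc t
  ... | yes x≤t with go fuel (suc t ∸ x) (≤-trans (s≤s (∸-monoʳ-≤ (suc t) h)) t<fuel)
                       (All-rotL 1 (h ∷ p)) s (trans (sym (compWord-rotL-past (suc t) x as h x≤t)) e)
  ...   | k , ek = suc k , trans (compWord-rotL-past (suc t) x as h x≤t) ek
  go (suc fuel) (suc t) {x ∷ as} _ (h ∷ p) s e | no x≰t with compWord-rotL-inside t x as h (≰⇒> x≰t)
  ... | s' , e' with trans (sym e') e
  ... | ()

-- The word of a composition is empty or starts with a one, so a composition
-- is recovered from its word by counting the zeros after each one.
StartsWithOne : List Bool → Set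
StartsWithOne u = u ≡ [] ⊎ ∃ λ s → u ≡ true ∷ s

compWord-startsWithOne : ∀ {a} → Positive a → StartsWithOne (compWord a)
compWord-startsWithOne [] = inj₁ refl
compWord-startsWithOne {suc x ∷ as} (h ∷ p) = inj₂ (_ , refl)

falses-cancel : ∀ x y u v → StartsWithOne u → StartsWithOne v →
  replicate x false ++ u ≡ replicate y false ++ v → x ≡ y × u ≡ v
falses-cancel zero zero u v _ _ e = refl , e
falses-cancel zero (suc y) u v (inj₁ refl) _ ()
falses-cancel zero (suc y) u v (inj₂ (s , refl)) _ ()
falses-cancel (suc x) zero u v _ (inj₁ refl) ()
falses-cancel (suc x) zero u v _ (inj₂ (s , refl)) ()
falses-cancel (suc x) (suc y) u v su sv e with falses-cancel x y u v su sv (proj₂ (∷-injective e))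
... | e1 , e2 = cong suc e1 , e2

compWord-injective : ∀ {a b} → Positive a → Positive b → compWord a ≡ compWord b → a ≡ b
compWord-injective [] [] e = refl
compWord-injective {[]} {suc y ∷ bs} [] (_ ∷ _) ()
compWord-injective {suc x ∷ as} {[]} (_ ∷ _) [] ()
compWord-injective {suc x ∷ as} {suc y ∷ bs} (_ ∷ pa) (_ ∷ pb) e
  with falses-cancel x y (compWord as) (compWord bs)
         (compWord-startsWithOne pa) (compWord-startsWithOne pb) (proj₂ (∷-injective e))
... | e1 , e2 = cong₂ _∷_ (cong suc e1) (compWord-injective pa pb e2)

rotation-fromWord : ∀ (a c : List ℕ) → Positive a → Positive c → ∀ t →
  compWord c ≡ rotL t (compWord a) → (∃ λ s → compWord c ≡ true ∷ s) → ∃ λ k → rotL k a ≡ c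
rotation-fromWord a c pa pc t e (s , hs) with compWord-rotL-atOne t pa s (trans (sym e) hs)
... | k , e2 = k , compWord-injective (All-rotL k pa) pc (trans (sym e2) (sym e))

-- Refinement is the componentwise order of composition words: splitting a
-- part only adds ones to its word.
partWord≼compWord : ∀ bl → bl ≢ [] → Positive bl → partWord (sum bl) ≼ compWord bl
partWord≼compWord [] ne _ = ⊥-elim (ne refl)
partWord≼compWord (suc c ∷ cs) ne (_ ∷ p) = b≤b ∷ falses≼ (c + sum cs) (replicate c false ++ compWord cs)
  (trans (length-++ (replicate c false)) (cong₂ _+_ (length-replicate c) (length-compWord p)))

refines⇒compWord≼ : ∀ {a b} → Refines a b → Positive b → compWord a ≼ compWord b
refines⇒compWord≼ (blocks , nes , refl , refl) = go blocks nes
  where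
    go : ∀ blocks → All (_≢ []) blocks → Positive (concat blocks) →
      compWord (map sum blocks) ≼ compWord (concat blocks)
    go [] _ _ = []
    go (bl ∷ bls) (ne ∷ nes) p with All-++⁻ bl p
    ... | p1 , p2 = subst (partWord (sum bl) ++ compWord (map sum bls) ≼_) (sym (compWord-++ bl (concat bls)))
                      (PW.++⁺ (partWord≼compWord bl ne p1) (go bls nes p2))

refines-cons : ∀ c {as bs} → Refines as bs → Refines (c ∷ as) (c ∷ bs)
refines-cons c (blocks , nes , ms , cc) =
  ((c ∷ []) ∷ blocks) , ((λ ()) ∷ nes) , cong₂ _∷_ (+-identityʳ c) ms , cong (c ∷_) cc

refines-merge : ∀ e {c as bs} → Refines (c ∷ as) bs → Refines (e + c ∷ as) (e ∷ bs)
refines-merge e ([] , _ , () , _)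
refines-merge e ((bl ∷ bls) , ne ∷ nes , ms , cc) =
  ((e ∷ bl) ∷ bls) , ((λ ()) ∷ nes) ,
  cong₂ _∷_ (cong (e +_) (proj₁ (∷-injective ms))) (proj₂ (∷-injective ms)) , cong (e ∷_) cc

falses-cancelˡ : ∀ x d {u v} → replicate x false ++ u ≼ replicate (suc x + d) false ++ v →
  u ≼ false ∷ replicate d false ++ v
falses-cancelˡ zero d h = h
falses-cancelˡ (suc x) d (_ ∷ h) = falses-cancelˡ x d h

falses-cancelʳ : ∀ y d {u v} → replicate (suc y + d) false ++ u ≼ replicate y false ++ v →
  false ∷ replicate d false ++ u ≼ v
falses-cancelʳ zero d h = h
falses-cancelʳ (suc y) d (_ ∷ h) = falses-cancelʳ y d h

-- Conversely, comparable words come from a refinement; refines-head treats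
-- compositions with first parts x + 1 and y + 1 (their words after the
-- leading one).
compWord≼⇒refines : ∀ {a b} → Positive a → Positive b → compWord a ≼ compWord b → Refines a b
refines-head : ∀ x as y bs → Positive as → Positive bs →
  replicate x false ++ compWord as ≼ replicate y false ++ compWord bs → Refines (suc x ∷ as) (suc y ∷ bs)

compWord≼⇒refines {[]} {[]} _ _ _ = [] , [] , refl , refl
compWord≼⇒refines {[]} {suc y ∷ bs} _ _ ()
compWord≼⇒refines {suc x ∷ as} {[]} _ _ ()
compWord≼⇒refines {suc x ∷ as} {suc y ∷ bs} (_ ∷ pa) (_ ∷ pb) (_ ∷ h) = refines-head x as y bs pa pb h

-- Compare the first parts: equal first parts are kept, a first part of b
-- that is too short is merged into the first block, and a first part of a
-- that is too short would leave a one of a uncovered.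
refines-head x as y bs pa pb h with <-cmp x y
... | tri≈ _ refl _ = refines-cons (suc x) (compWord≼⇒refines pa pb (PW.++-cancelˡ (replicate x false) h))
... | tri< x<y _ _ with m≤n⇒∃[o]m+o≡n x<y
...   | d , refl with as | pa | falses-cancelˡ x d h
...     | [] | _ | ()
...     | suc _ ∷ _ | _ | () ∷ _
refines-head x as y bs pa pb h | tri> _ _ y<x with m≤n⇒∃[o]m+o≡n y<x
... | d , refl with bs | pb | falses-cancelʳ y d {compWord as} h
...   | suc y' ∷ bs' | _ ∷ pb' | _ ∷ h' = subst (λ z → Refines (z ∷ as) (suc y ∷ suc y' ∷ bs'))
          (+-suc (suc y) d) (refines-merge (suc y) (refines-head d as y' bs' pa pb' h'))

-- Counting ones in a binary word; this is the rank on both sides.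
ones : List Bool → ℕ
ones [] = 0
ones (true ∷ w) = suc (ones w)
ones (false ∷ w) = ones w

ones-++ : ∀ p q → ones (p ++ q) ≡ ones p + ones q
ones-++ [] q = refl
ones-++ (true ∷ p) q = cong suc (ones-++ p q)
ones-++ (false ∷ p) q = ones-++ p q

ones-falses : ∀ k → ones (replicate k false) ≡ 0
ones-falses zero = refl
ones-falses (suc k) = ones-falses k

ones-compWord : ∀ {a} → Positive a → ones (compWord a) ≡ length a
ones-compWord [] = refl
ones-compWord {suc x ∷ as} (_ ∷ p) =
  cong suc (trans (ones-++ (replicate x false) (compWord as)) (cong₂ _+_ (ones-falses x) (ones-compWord p)))

block : ℕ → ℕ → List Bool
block zero a = []
block (suc M) zero = false ∷ block M zero
block (suc M) (suc a) = true ∷ block M a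

blockWord : ℕ → List ℕ → List Bool
blockWord m [] = []
blockWord m (v ∷ vs) = block m v ++ blockWord m vs

length-block : ∀ M a → length (block M a) ≡ M
length-block zero a = refl
length-block (suc M) zero = cong suc (length-block M zero)
length-block (suc M) (suc a) = cong suc (length-block M a)

length-blockWord : ∀ m x → length (blockWord m x) ≡ length x * m
length-blockWord m [] = refl
length-blockWord m (v ∷ vs) = trans (length-++ (block m v)) (cong₂ _+_ (length-block m v) (length-blockWord m vs))

ones-block : ∀ M a → a ≤ M → ones (block M a) ≡ a
ones-block zero zero _ = refl
ones-block (suc M) zero _ = ones-block M zero z≤n
ones-block (suc M) (suc a) (s≤s h) = cong suc (ones-block M a h)

ones-blockWord : ∀ m {x} → All (_≤ m) x → ones (blockWord m x) ≡ sum x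
ones-blockWord m [] = refl
ones-blockWord m {v ∷ vs} (h ∷ hs) =
  trans (ones-++ (block m v) (blockWord m vs)) (cong₂ _+_ (ones-block m v h) (ones-blockWord m hs))

block-split : ∀ M a → a ≤ M → block M a ≡ replicate a true ++ replicate (M ∸ a) false
block-split zero zero _ = refl
block-split (suc M) zero _ = cong (false ∷_) (block-split M zero z≤n)
block-split (suc M) (suc a) (s≤s h) = cong (true ∷_) (block-split M a h)

block-full : ∀ M → block M M ≡ replicate M true
block-full zero = refl
block-full (suc M) = cong (true ∷_) (block-full M)

blockWord-++ : ∀ m p q → blockWord m (p ++ q) ≡ blockWord m p ++ blockWord m q
blockWord-++ m [] q = refl
blockWord-++ m (a ∷ p) q =
  trans (cong (block m a ++_) (blockWord-++ m p q)) (sym (++-assoc (block m a) (blockWord m p) (blockWord m q)))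

blockWord-rotL : ∀ m k x → blockWord m (rotL k x) ≡ rotL (k * m) (blockWord m x)
blockWord-rotL m zero x = refl
blockWord-rotL m (suc k) [] = trans (cong (blockWord m) (rotL-[] k)) (sym (rotL-[] (suc k * m)))
blockWord-rotL m (suc k) (v ∷ vs) = begin
  blockWord m (rotL k (vs ++ [ v ]))         ≡⟨ blockWord-rotL m k (vs ++ [ v ]) ⟩
  rotL (k * m) (blockWord m (vs ++ [ v ]))   ≡⟨ cong (rotL (k * m)) rotOne ⟩
  rotL (k * m) (rotL m (blockWord m (v ∷ vs))) ≡⟨ sym (rotL-+ m (k * m) _) ⟩
  rotL (m + k * m) (blockWord m (v ∷ vs))    ∎
  where
    rotOne : blockWord m (vs ++ [ v ]) ≡ rotL m (blockWord m (v ∷ vs))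
    rotOne = begin
      blockWord m (vs ++ [ v ])          ≡⟨ blockWord-++ m vs [ v ] ⟩
      blockWord m vs ++ block m v ++ [] ≡⟨ cong (blockWord m vs ++_) (++-identityʳ (block m v)) ⟩
      blockWord m vs ++ block m v       ≡⟨ sym (rotL-++ (block m v) (blockWord m vs)) ⟩
      rotL (length (block m v)) (blockWord m (v ∷ vs)) ≡⟨ cong (λ z → rotL z (blockWord m (v ∷ vs))) (length-block m v) ⟩
      rotL m (blockWord m (v ∷ vs))     ∎

block-mono : ∀ M {a b} → a ≤ b → block M a ≼ block M b
block-mono zero h = []
block-mono (suc M) {zero} {zero} h = b≤b ∷ block-mono M z≤n
block-mono (suc M) {zero} {suc b} h = f≤t ∷ block-mono M z≤n
block-mono (suc M) {suc a} {suc b} (s≤s h) = b≤b ∷ block-mono M h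

blockWord-mono : ∀ m {x y} → Pointwise _≤_ x y → blockWord m x ≼ blockWord m y
blockWord-mono m [] = []
blockWord-mono m (h ∷ hs) = PW.++⁺ (block-mono m h) (blockWord-mono m hs)

-- A block 1^a 0^(M-a) with a larger than the number c < M of leading ones
-- of a block below it would put a one over the first zero of that block.
block≼block : ∀ N a M c {S T} → M ≤ N → c < M → block N a ++ S ≼ block M c ++ T → a ≤ c
block≼block N zero M c _ _ _ = z≤n
block≼block N (suc a) zero c _ () _
block≼block zero (suc a) (suc M) c () _ _
block≼block (suc N) (suc a) (suc M) zero _ _ (() ∷ _)
block≼block (suc N) (suc a) (suc M) (suc c) (s≤s M≤N) (s≤s c<M) (_ ∷ h) = s≤s (block≼block N a M c M≤N c<M h)

drop-block : ∀ r M b → drop r (block M b) ≡ block (M ∸ r) (b ∸ r)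
drop-block zero M b = refl
drop-block (suc r) zero b = refl
drop-block (suc r) (suc M) zero = trans (drop-block r M zero) (cong (block (M ∸ r)) (0∸n≡0 r))
drop-block (suc r) (suc M) (suc b) = drop-block r M b

∸-<-∸ : ∀ {b m r} → b < m → r < m → b ∸ r < m ∸ r
∸-<-∸ {b} {m} {r} b<m r<m with r ≤? b
... | yes r≤b = ∸-monoˡ-< b<m r≤b
... | no r≰b = subst (_< m ∸ r) (sym (m≤n⇒m∸n≡0 (<⇒≤ (≰⇒> r≰b)))) (m<n⇒0<n∸m r<m)

-- A block compared with a word shifted by r < m inside another block:
-- either that block is full, or the comparison happens against its
-- remaining b ∸ r ones followed by a zero.
block≼dropBlock : ∀ m r a b {S T} → r < m → a ≤ m → block m a ++ S ≼ drop r (block m b) ++ T → a ≤ b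
block≼dropBlock m r a b {S} {T} r<m a≤m h with b <? m
... | yes b<m = ≤-trans (block≼block m a (m ∸ r) (b ∸ r) (m∸n≤m m r) (∸-<-∸ b<m r<m)
                  (subst (λ z → block m a ++ S ≼ z ++ T) (drop-block r m b) h)) (m∸n≤m b r)
... | no b≮m = ≤-trans a≤m (≮⇒≥ b≮m)

length-window : ∀ m r a b → r ≤ m → length (drop r (block m a) ++ take r (block m b)) ≡ m
length-window m r a b r≤m = begin
  length (drop r (block m a) ++ take r (block m b))           ≡⟨ length-++ (drop r (block m a)) ⟩
  length (drop r (block m a)) + length (take r (block m b))   ≡⟨ cong₂ _+_ (length-drop r (block m a)) (length-take r (block m b)) ⟩
  length (block m a) ∸ r + r ⊓ length (block m b)             ≡⟨ cong₂ (λ u v → u ∸ r + r ⊓ v) (length-block m a) (length-block m b) ⟩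
  m ∸ r + r ⊓ m                                               ≡⟨ cong (m ∸ r +_) (m≤n⇒m⊓n≡m r≤m) ⟩
  m ∸ r + r                                                   ≡⟨ m∸n+n≡m r≤m ⟩
  m                                                           ∎

blockWord≼shifted : ∀ m r → r < m → ∀ u0 us v0 vs T → length us ≡ length vs → All (_≤ m) (u0 ∷ us) →
  blockWord m (u0 ∷ us) ≼ drop r (block m v0) ++ blockWord m vs ++ T → Pointwise _≤_ (u0 ∷ us) (v0 ∷ vs)
blockWord≼shifted m r r<m u0 [] v0 [] T _ (u0≤m ∷ _) h = block≼dropBlock m r u0 v0 r<m u0≤m h ∷ []
blockWord≼shifted m r r<m u0 (u1 ∷ us) v0 (v1 ∷ vs) T le (u0≤m ∷ us≤m) h =
  block≼dropBlock m r u0 v0 r<m u0≤m h ∷ blockWord≼shifted m r r<m u1 us v1 vs T (cong pred le) us≤m tail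
  where
    window = drop r (block m v0) ++ take r (block m v1)
    regroup : drop r (block m v0) ++ blockWord m (v1 ∷ vs) ++ T ≡ window ++ drop r (block m v1) ++ blockWord m vs ++ T
    regroup = begin
      drop r (block m v0) ++ (block m v1 ++ blockWord m vs) ++ T
        ≡⟨ cong (λ z → drop r (block m v0) ++ (z ++ blockWord m vs) ++ T) (sym (take++drop≡id r (block m v1))) ⟩
      drop r (block m v0) ++ ((take r (block m v1) ++ drop r (block m v1)) ++ blockWord m vs) ++ T
        ≡⟨ cong (λ z → drop r (block m v0) ++ z ++ T) (++-assoc (take r (block m v1)) _ _) ⟩
      drop r (block m v0) ++ (take r (block m v1) ++ drop r (block m v1) ++ blockWord m vs) ++ T
        ≡⟨ cong (drop r (block m v0) ++_) (++-assoc (take r (block m v1)) _ T) ⟩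
      drop r (block m v0) ++ take r (block m v1) ++ (drop r (block m v1) ++ blockWord m vs) ++ T
        ≡⟨ cong (λ z → drop r (block m v0) ++ take r (block m v1) ++ z) (++-assoc (drop r (block m v1)) _ T) ⟩
      drop r (block m v0) ++ take r (block m v1) ++ drop r (block m v1) ++ blockWord m vs ++ T
        ≡⟨ sym (++-assoc (drop r (block m v0)) _ _) ⟩
      window ++ drop r (block m v1) ++ blockWord m vs ++ T ∎
    tail : blockWord m (u1 ∷ us) ≼ drop r (block m v1) ++ blockWord m vs ++ T
    tail = proj₂ (Pointwise-++⁻ (block m u0) window
      (trans (length-block m u0) (sym (length-window m r v0 v1 (<⇒≤ r<m)))) (subst (_ ≼_) regroup h))

-- Write the shift as qm + r with r < m; rotating v by q reduces to r < m.
blockWord-shift : ∀ m → 1 ≤ m → ∀ u v t → length u ≡ length v → All (_≤ m) u →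
  blockWord m u ≼ rotL t (blockWord m v) → ∃ λ q → Pointwise _≤_ u (rotL q v)
blockWord-shift (suc m') _ u v t le u≤m h = q , entrywise u (rotL q v) u≤m (trans le (sym (length-rotL q v))) h'
  where
    m = suc m'
    q = t / m
    r = t % m
    r<m : r < m
    r<m = m%n<n t m
    h' : blockWord m u ≼ rotL r (blockWord m (rotL q v))
    h' = subst (blockWord m u ≼_) (begin
      rotL t (blockWord m v)                   ≡⟨ cong (λ z → rotL z (blockWord m v)) (trans (m≡m%n+[m/n]*n t m) (+-comm r (q * m))) ⟩
      rotL (q * m + r) (blockWord m v)         ≡⟨ rotL-+ (q * m) r (blockWord m v) ⟩
      rotL r (rotL (q * m) (blockWord m v))    ≡⟨ cong (rotL r) (sym (blockWord-rotL m q v)) ⟩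
      rotL r (blockWord m (rotL q v))          ∎) h
    entrywise : ∀ u' v' → All (_≤ m) u' → length u' ≡ length v' → blockWord m u' ≼ rotL r (blockWord m v') → Pointwise _≤_ u' v'
    entrywise [] [] _ _ _ = []
    entrywise (u0 ∷ us) (v0 ∷ vs) u'≤m le' h2 = blockWord≼shifted m r r<m u0 us v0 vs (take r (block m v0)) (cong pred le') u'≤m
      (subst (_ ≼_) (rotL-drop r (block m v0) (blockWord m vs) (≤-trans (<⇒≤ r<m) (≤-reflexive (sym (length-block m v0))))) h2)

-- A run (a , b) is the composition 1^a (b+1), whose word is the maximal run
-- 1^(a+1) 0^b of a binary word.
Run : Set
Run = ℕ × ℕ

runComp : Run → List ℕ
runComp (a , b) = replicate a 1 ++ [ suc b ]

runWord : Run → List Bool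
runWord (a , b) = replicate (suc a) true ++ replicate b false

AlignedRun : ℕ → Run → Set
AlignedRun m (a , b) = 1 ≤ b × m ∣ suc a + b

runsComp : List Run → List ℕ
runsComp rs = concat (map runComp rs)

runsWord : List Run → List Bool
runsWord rs = concat (map runWord rs)

compWord-ones : ∀ a → compWord (replicate a 1) ≡ replicate a true
compWord-ones zero = refl
compWord-ones (suc a) = cong (true ∷_) (compWord-ones a)

compWord-runsComp : ∀ rs → compWord (runsComp rs) ≡ runsWord rs
compWord-runsComp [] = refl
compWord-runsComp ((a , b) ∷ rs) = begin
  compWord (runComp (a , b) ++ runsComp rs)                ≡⟨ compWord-++ (runComp (a , b)) (runsComp rs) ⟩
  compWord (replicate a 1 ++ [ suc b ]) ++ compWord (runsComp rs)
    ≡⟨ cong₂ _++_ (compWord-++ (replicate a 1) [ suc b ]) (compWord-runsComp rs) ⟩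
  (compWord (replicate a 1) ++ partWord (suc b) ++ []) ++ runsWord rs
    ≡⟨ cong₂ (λ u v → (u ++ v) ++ runsWord rs) (compWord-ones a) (++-identityʳ (partWord (suc b))) ⟩
  (replicate a true ++ true ∷ replicate b false) ++ runsWord rs
    ≡⟨ cong (_++ runsWord rs) (replicate-snoc a true (replicate b false)) ⟩
  runWord (a , b) ++ runsWord rs                           ∎

Positive-runsComp : ∀ rs → Positive (runsComp rs)
Positive-runsComp [] = []
Positive-runsComp ((a , b) ∷ rs) = All-++⁺ (All-++⁺ (ones-positive a) (s≤s z≤n ∷ [])) (Positive-runsComp rs)
  where
    ones-positive : ∀ a → Positive (replicate a 1)
    ones-positive zero = []
    ones-positive (suc a) = s≤s z≤n ∷ ones-positive a

-- A vector is good when its first entry is positive and its last entry is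
-- below m: then its block word starts with a one and ends with a zero, so
-- it cuts into whole runs.
data LastBelow (m : ℕ) : List ℕ → Set where
  end : ∀ {v} → v < m → LastBelow m (v ∷ [])
  _∷_ : ∀ v {y ys} → LastBelow m (y ∷ ys) → LastBelow m (v ∷ y ∷ ys)

HeadPositive : List ℕ → Set
HeadPositive [] = ⊥
HeadPositive (v ∷ _) = 1 ≤ v

Good : ℕ → List ℕ → Set
Good m x = HeadPositive x × LastBelow m x

blockWord-headOne : ∀ m → 1 ≤ m → ∀ x → HeadPositive x → ∃ λ s → blockWord m x ≡ true ∷ s
blockWord-headOne (suc m) _ (suc v ∷ vs) _ = _ , refl

LastBelow-snoc : ∀ {m} p a → a < m → LastBelow m (p ++ [ a ])
LastBelow-snoc [] a h = end h
LastBelow-snoc (p0 ∷ []) a h = p0 ∷ end h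
LastBelow-snoc (p0 ∷ p1 ∷ p) a h = p0 ∷ LastBelow-snoc (p1 ∷ p) a h

LastBelow-all : ∀ {m y ys} → All (_< m) (y ∷ ys) → LastBelow m (y ∷ ys)
LastBelow-all (h ∷ []) = end h
LastBelow-all (_ ∷ h2 ∷ hs) = _ ∷ LastBelow-all (h2 ∷ hs)

Descent : ℕ → List ℕ → Set
Descent m x = Σ (List ℕ) λ u → Σ ℕ λ a → Σ ℕ λ b → Σ (List ℕ) λ v → x ≡ u ++ a ∷ b ∷ v × a < m × 1 ≤ b

-- A vector with a positive entry and an entry below m has a descent or is
-- good: without a descent at the front, either the tail has both kinds of
-- entries (use the tail's answer), or the tail is all zero (so the head is
-- positive).
DescentOrGood : ℕ → List ℕ → Set
DescentOrGood m x = Any (1 ≤_) x → Any (_< m) x → Descent m x ⊎ Good m x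

descentOrGood-cons : ∀ m → 1 ≤ m → ∀ a b r → DescentOrGood m (b ∷ r) → DescentOrGood m (a ∷ b ∷ r)
descentOrGood-cons m m≥1 a b r tail pos below with (a <? m) ×-dec (1 ≤? b)
... | yes (a<m , b≥1) = inj₁ ([] , a , b , r , refl , a<m , b≥1)
... | no ¬front with any? (1 ≤?_) (b ∷ r) | any? (_<? m) (b ∷ r)
...   | yes pos' | yes below' with tail pos' below'
...     | inj₁ (u , a' , b' , v , e , l , p) = inj₁ (a ∷ u , a' , b' , v , cong (a ∷_) e , l , p)
...     | inj₂ (b≥1 , last) = inj₂ (≤-trans m≥1 (≮⇒≥ (λ a<m → ¬front (a<m , b≥1))) , a ∷ last)
descentOrGood-cons m m≥1 a b r tail pos below | no ¬front | no ¬pos' | _ =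
  inj₂ (headPositive pos , a ∷ LastBelow-all (All.map (λ ¬b≥1 → <-≤-trans (≰⇒> ¬b≥1) m≥1) (¬Any⇒All¬ (b ∷ r) ¬pos')))
  where
    headPositive : Any (1 ≤_) (a ∷ b ∷ r) → 1 ≤ a
    headPositive (here a≥1) = a≥1
    headPositive (there q) = ⊥-elim (¬pos' q)
descentOrGood-cons m m≥1 a b r tail pos below | no ¬front | yes pos' | no ¬below' =
  ⊥-elim (¬front (headBelow below , ≤-trans m≥1 (≮⇒≥ (λ b<m → ¬below' (here b<m)))))
  where
    headBelow : Any (_< m) (a ∷ b ∷ r) → a < m
    headBelow (here a<m) = a<m
    headBelow (there q) = ⊥-elim (¬below' q)

descentOrGood : ∀ m → 1 ≤ m → ∀ x → DescentOrGood m x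
descentOrGood m m≥1 (a ∷ []) (here a≥1) (here a<m) = inj₂ (a≥1 , end a<m)
descentOrGood m m≥1 (a ∷ b ∷ r) = descentOrGood-cons m m≥1 a b r (descentOrGood m m≥1 (b ∷ r))

-- Rotating to just after a descent (or not at all) gives a good vector.
goodRotation : ∀ m → 1 ≤ m → ∀ x → Any (1 ≤_) x → Any (_< m) x → ∃ λ k → Good m (rotL k x)
goodRotation m m≥1 x pos below with descentOrGood m m≥1 x pos below
... | inj₂ good = 0 , good
... | inj₁ (u , a , b , v , refl , a<m , b≥1) =
  length (u ++ [ a ]) , subst (Good m) (sym rotated) (b≥1 , LastBelow-snoc (b ∷ v ++ u) a a<m)
  where
    rotated : rotL (length (u ++ [ a ])) (u ++ a ∷ b ∷ v) ≡ (b ∷ v ++ u) ++ [ a ]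
    rotated = begin
      rotL (length (u ++ [ a ])) (u ++ a ∷ b ∷ v)   ≡⟨ cong (rotL (length (u ++ [ a ]))) (sym (++-assoc u [ a ] (b ∷ v))) ⟩
      rotL (length (u ++ [ a ])) ((u ++ [ a ]) ++ b ∷ v) ≡⟨ rotL-++ (u ++ [ a ]) (b ∷ v) ⟩
      b ∷ v ++ u ++ [ a ]                          ≡⟨ cong (b ∷_) (sym (++-assoc v u [ a ])) ⟩
      (b ∷ v ++ u) ++ [ a ]                        ∎

-- Inside a block ones precede zeros, so a run can only end at a block
-- boundary.  We read the block word left to right in two states: after
-- P ≥ 0 ones of the current run (P a multiple of m), and after A ≥ 1 ones
-- and B ≥ 1 zeros of the current run (A + B a multiple of m).
runsAfterOnes : ∀ m → 1 ≤ m → ∀ x P → All (_≤ m) x → LastBelow m x → m ∣ P → (1 ≤ P ⊎ HeadPositive x) →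
  ∃ λ rs → All (AlignedRun m) rs × runsWord rs ≡ replicate P true ++ blockWord m x
runsAfterOnesZeros : ∀ m → 1 ≤ m → ∀ x A B → All (_≤ m) x → (x ≡ [] ⊎ LastBelow m x) → 1 ≤ A → 1 ≤ B → m ∣ A + B →
  ∃ λ rs → All (AlignedRun m) rs × runsWord rs ≡ replicate A true ++ replicate B false ++ blockWord m x

-- A full block extends the ones; a block 1^v 0^(m-v), v < m, starts the zeros.
runsAfterOnes m m≥1 (v ∷ xs) P (v≤m ∷ xs≤m) last m∣P started with m ≤? v
runsAfterOnes m m≥1 (v ∷ []) P (v≤m ∷ xs≤m) (end v<m) m∣P started | yes m≤v = ⊥-elim (<⇒≱ v<m m≤v)
runsAfterOnes m m≥1 (v ∷ y ∷ ys) P (v≤m ∷ xs≤m) (_ ∷ last) m∣P started | yes m≤v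
  with runsAfterOnes m m≥1 (y ∷ ys) (P + m) xs≤m last (∣m∣n⇒∣m+n m∣P ∣-refl) (inj₁ (≤-trans m≥1 (m≤n+m m P)))
... | rs , aligned , e = rs , aligned , (begin
  runsWord rs                                               ≡⟨ e ⟩
  replicate (P + m) true ++ blockWord m (y ∷ ys)             ≡⟨ cong (_++ blockWord m (y ∷ ys)) (replicate-+ P m true) ⟩
  (replicate P true ++ replicate m true) ++ blockWord m (y ∷ ys) ≡⟨ ++-assoc (replicate P true) _ _ ⟩
  replicate P true ++ replicate m true ++ blockWord m (y ∷ ys)
    ≡⟨ cong (λ z → replicate P true ++ z ++ blockWord m (y ∷ ys)) (sym (trans (cong (block m) (≤-antisym v≤m m≤v)) (block-full m))) ⟩
  replicate P true ++ block m v ++ blockWord m (y ∷ ys)      ∎)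
runsAfterOnes m m≥1 (v ∷ xs) P (v≤m ∷ xs≤m) last m∣P started | no m≰v
  with runsAfterOnesZeros m m≥1 xs (P + v) (m ∸ v) xs≤m (tailEnds last) (onesStarted started)
         (m<n⇒0<n∸m (≰⇒> m≰v)) (subst (m ∣_) regroup (∣m∣n⇒∣m+n m∣P ∣-refl))
  where
    tailEnds : ∀ {xs} → LastBelow m (v ∷ xs) → xs ≡ [] ⊎ LastBelow m xs
    tailEnds (end _) = inj₁ refl
    tailEnds (_ ∷ l) = inj₂ l
    onesStarted : (1 ≤ P ⊎ HeadPositive (v ∷ xs)) → 1 ≤ P + v
    onesStarted (inj₁ p) = ≤-trans p (m≤m+n P v)
    onesStarted (inj₂ p) = ≤-trans p (m≤n+m v P)
    regroup : P + m ≡ P + v + (m ∸ v)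
    regroup = trans (cong (P +_) (sym (m+[n∸m]≡n v≤m))) (sym (+-assoc P v (m ∸ v)))
... | rs , aligned , e = rs , aligned , (begin
  runsWord rs                                                               ≡⟨ e ⟩
  replicate (P + v) true ++ replicate (m ∸ v) false ++ blockWord m xs       ≡⟨ cong (_++ _) (replicate-+ P v true) ⟩
  (replicate P true ++ replicate v true) ++ replicate (m ∸ v) false ++ blockWord m xs ≡⟨ ++-assoc (replicate P true) _ _ ⟩
  replicate P true ++ replicate v true ++ replicate (m ∸ v) false ++ blockWord m xs
    ≡⟨ cong (replicate P true ++_) (sym (++-assoc (replicate v true) _ _)) ⟩
  replicate P true ++ (replicate v true ++ replicate (m ∸ v) false) ++ blockWord m xs
    ≡⟨ cong (λ z → replicate P true ++ z ++ blockWord m xs) (sym (block-split m v v≤m)) ⟩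
  replicate P true ++ block m v ++ blockWord m xs                           ∎)

-- The end of the word or a block starting with a one closes the run; an
-- empty block extends the zeros.
runsAfterOnesZeros m m≥1 [] (suc A) B _ _ _ B≥1 m∣A+B =
  ((A , B) ∷ []) , ((B≥1 , m∣A+B) ∷ []) , ++-assoc (replicate (suc A) true) (replicate B false) []
runsAfterOnesZeros m m≥1 (zero ∷ xs) A B (_ ∷ xs≤m) ends A≥1 B≥1 m∣A+B
  with runsAfterOnesZeros m m≥1 xs A (B + m) xs≤m (tailEnds ends) A≥1 (≤-trans B≥1 (m≤m+n B m))
         (subst (m ∣_) (+-assoc A B m) (∣m∣n⇒∣m+n m∣A+B ∣-refl))
  where
    tailEnds : (zero ∷ xs ≡ [] ⊎ LastBelow m (zero ∷ xs)) → xs ≡ [] ⊎ LastBelow m xs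
    tailEnds (inj₂ (end _)) = inj₁ refl
    tailEnds (inj₂ (_ ∷ l)) = inj₂ l
... | rs , aligned , e = rs , aligned , (begin
  runsWord rs                                                         ≡⟨ e ⟩
  replicate A true ++ replicate (B + m) false ++ blockWord m xs
    ≡⟨ cong (λ z → replicate A true ++ z ++ blockWord m xs) (replicate-+ B m false) ⟩
  replicate A true ++ (replicate B false ++ replicate m false) ++ blockWord m xs
    ≡⟨ cong (replicate A true ++_) (++-assoc (replicate B false) _ _) ⟩
  replicate A true ++ replicate B false ++ replicate m false ++ blockWord m xs
    ≡⟨ cong (λ z → replicate A true ++ replicate B false ++ z ++ blockWord m xs) (sym (block-split m 0 z≤n)) ⟩
  replicate A true ++ replicate B false ++ block m 0 ++ blockWord m xs ∎)
runsAfterOnesZeros m m≥1 (suc u ∷ xs) (suc A) B xs≤m (inj₂ last) _ B≥1 m∣A+B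
  with runsAfterOnes m m≥1 (suc u ∷ xs) 0 xs≤m last (m ∣0) (inj₂ (s≤s z≤n))
... | rs , aligned , e = ((A , B) ∷ rs) , ((B≥1 , m∣A+B) ∷ aligned) ,
  trans (cong (runWord (A , B) ++_) e) (++-assoc (replicate (suc A) true) _ _)

runsOfGood : ∀ m → 1 ≤ m → ∀ x → All (_≤ m) x → Good m x →
  ∃ λ rs → All (AlignedRun m) rs × runsWord rs ≡ blockWord m x
runsOfGood m m≥1 x x≤m (head , last) = runsAfterOnes m m≥1 x 0 x≤m last (m ∣0) (inj₂ head)

PositiveTails : List Run → Set
PositiveTails = All (λ r → 1 ≤ proj₂ r)

aligned⇒positiveTails : ∀ {m rs} → All (AlignedRun m) rs → PositiveTails rs
aligned⇒positiveTails = All.map proj₁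

-- The part π assigns to a run 1^a (b+1): the absorbed ones plus b + 1, in
-- the form computed by πgo; it is the length of the run's word.
fundamentalPart : Run → ℕ
fundamentalPart (a , b) = suc b + (a + 0)

fundamentalPart-≡ : ∀ a b → fundamentalPart (a , b) ≡ suc a + b
fundamentalPart-≡ a b = trans (cong (suc b +_) (+-identityʳ a)) (cong suc (+-comm b a))

πgo-run : ∀ a b rest acc ys t → 1 ≤ b → πgo rest 0 ≡ (ys , t) →
  πgo (runComp (a , b) ++ rest) acc ≡ ((suc b + (a + acc)) ∷ ys , t)
πgo-run zero (suc b) rest acc ys t _ e rewrite e = refl
πgo-run (suc a) b rest acc ys t b≥1 e = trans (πgo-run a b rest (suc acc) ys t b≥1 e)
  (cong (λ z → (suc b + z) ∷ ys , t) (+-suc a acc))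

πgo-runsComp : ∀ rs rest ys t → PositiveTails rs → πgo rest 0 ≡ (ys , t) →
  πgo (runsComp rs ++ rest) 0 ≡ (map fundamentalPart rs ++ ys , t)
πgo-runsComp [] rest ys t _ e = e
πgo-runsComp ((a , b) ∷ rs) rest ys t (b≥1 ∷ tails) e =
  trans (cong (λ z → πgo z 0) (++-assoc (runComp (a , b)) (runsComp rs) rest))
        (πgo-run a b (runsComp rs ++ rest) 0 (map fundamentalPart rs ++ ys) t b≥1 (πgo-runsComp rs rest ys t tails e))

πgo-ones : ∀ t acc → πgo (replicate t 1) acc ≡ ([] , t + acc)
πgo-ones zero acc = refl
πgo-ones (suc t) acc = trans (πgo-ones t (suc acc)) (cong ([] ,_) (+-suc t acc))

πN-cons : ∀ xs y ys t → πgo xs 0 ≡ (y ∷ ys , t) → πN xs ≡ (y + t) ∷ ys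
πN-cons xs y ys t e rewrite e = refl

πN-runs : ∀ r rs t → PositiveTails (r ∷ rs) →
  πN (runsComp (r ∷ rs) ++ replicate t 1) ≡ (fundamentalPart r + (t + 0)) ∷ map fundamentalPart rs ++ []
πN-runs r rs t tails = πN-cons (runsComp (r ∷ rs) ++ replicate t 1) (fundamentalPart r) (map fundamentalPart rs ++ []) (t + 0)
  (πgo-runsComp (r ∷ rs) (replicate t 1) [] (t + 0) tails (πgo-ones t 0))

runsComp-divisible : ∀ m rs → All (AlignedRun m) rs → DivisibleBy m (πN (runsComp rs))
runsComp-divisible m [] _ = []
runsComp-divisible m ((a , b) ∷ rs) aligned@((_ , m∣run) ∷ aligned') =
  subst (DivisibleBy m) (cong πN (++-identityʳ (runsComp ((a , b) ∷ rs))))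
    (subst (DivisibleBy m) (sym (πN-runs (a , b) rs 0 (aligned⇒positiveTails aligned)))
      (subst (m ∣_) (sym (trans (+-identityʳ _) (fundamentalPart-≡ a b))) m∣run ∷ rest rs aligned'))
  where
    rest : ∀ rs → All (AlignedRun m) rs → All (m ∣_) (map fundamentalPart rs ++ [])
    rest [] _ = []
    rest ((a , b) ∷ rs) ((_ , m∣run) ∷ aligned) = subst (m ∣_) (sym (fundamentalPart-≡ a b)) m∣run ∷ rest rs aligned

divisible⇒aligned : ∀ m a b rs t → PositiveTails ((a , b) ∷ rs) →
  DivisibleBy m (πN (runsComp ((a , b) ∷ rs) ++ replicate t 1)) → All (AlignedRun m) ((t + a , b) ∷ rs)
divisible⇒aligned m a b rs t tails@(b≥1 ∷ tails') div with subst (DivisibleBy m) (πN-runs (a , b) rs t tails) div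
... | m∣first ∷ m∣rest = (b≥1 , subst (m ∣_) wrap m∣first) ∷ rest rs tails' m∣rest
  where
    wrap : fundamentalPart (a , b) + (t + 0) ≡ suc (t + a) + b
    wrap = begin
      fundamentalPart (a , b) + (t + 0) ≡⟨ cong₂ _+_ (fundamentalPart-≡ a b) (+-identityʳ t) ⟩
      suc a + b + t                     ≡⟨ cong suc (+-comm (a + b) t) ⟩
      suc (t + (a + b))                 ≡⟨ cong suc (sym (+-assoc t a b)) ⟩
      suc (t + a) + b                   ∎
    rest : ∀ rs → PositiveTails rs → All (m ∣_) (map fundamentalPart rs ++ []) → All (AlignedRun m) rs
    rest [] _ _ = []
    rest ((a , b) ∷ rs) (b≥1 ∷ tails) (m∣run ∷ m∣rest) = (b≥1 , subst (m ∣_) (fundamentalPart-≡ a b) m∣run) ∷ rest rs tails m∣rest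

runDecomposition : ∀ b c → Positive b → ∃ λ rs → ∃ λ t → PositiveTails rs × replicate c 1 ++ b ≡ runsComp rs ++ replicate t 1
runDecomposition [] c _ = [] , c , [] , ++-identityʳ (replicate c 1)
runDecomposition (suc zero ∷ b) c (_ ∷ p) with runDecomposition b (suc c) p
... | rs , t , tails , e = rs , t , tails , trans (replicate-snoc c 1 b) e
runDecomposition (suc (suc q) ∷ b) c (_ ∷ p) with runDecomposition b 0 p
... | rs , t , tails , e = ((c , suc q) ∷ rs) , t , (s≤s z≤n ∷ tails) , (begin
  replicate c 1 ++ suc (suc q) ∷ b                               ≡⟨ cong (λ z → replicate c 1 ++ suc (suc q) ∷ z) e ⟩
  replicate c 1 ++ suc (suc q) ∷ (runsComp rs ++ replicate t 1)  ≡⟨ sym (++-assoc (replicate c 1) [ suc (suc q) ] _) ⟩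
  runComp (c , suc q) ++ runsComp rs ++ replicate t 1            ≡⟨ sym (++-assoc (runComp (c , suc q)) (runsComp rs) _) ⟩
  runsComp ((c , suc q) ∷ rs) ++ replicate t 1                   ∎)

blocksOfRun : ∀ m k a b → a + b ≡ k * m → ∃ λ xs → All (_≤ m) xs × blockWord m xs ≡ replicate a true ++ replicate b false
blocksOfRun m zero a b e rewrite m+n≡0⇒m≡0 a e | m+n≡0⇒n≡0 a e = [] , [] , refl
blocksOfRun m (suc k) a b e with m ≤? a
... | yes m≤a with blocksOfRun m k (a ∸ m) b
                     (+-cancelˡ-≡ m _ _ (trans (sym (+-assoc m (a ∸ m) b)) (trans (cong (_+ b) (m+[n∸m]≡n m≤a)) e)))
...   | xs , xs≤m , e' = (m ∷ xs) , (≤-refl ∷ xs≤m) , (begin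
  block m m ++ blockWord m xs                                          ≡⟨ cong₂ _++_ (block-full m) e' ⟩
  replicate m true ++ replicate (a ∸ m) true ++ replicate b false      ≡⟨ sym (++-assoc (replicate m true) _ _) ⟩
  (replicate m true ++ replicate (a ∸ m) true) ++ replicate b false    ≡⟨ cong (_++ replicate b false) (sym (replicate-+ m (a ∸ m) true)) ⟩
  replicate (m + (a ∸ m)) true ++ replicate b false                    ≡⟨ cong (λ z → replicate z true ++ replicate b false) (m+[n∸m]≡n m≤a) ⟩
  replicate a true ++ replicate b false                                ∎)
blocksOfRun m (suc k) a b e | no m≰a with blocksOfRun m k 0 (k * m) refl
... | xs , xs≤m , e' = (a ∷ xs) , (a≤m ∷ xs≤m) , (begin
  block m a ++ blockWord m xs                                              ≡⟨ cong₂ _++_ (block-split m a a≤m) e' ⟩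
  (replicate a true ++ replicate (m ∸ a) false) ++ replicate (k * m) false ≡⟨ ++-assoc (replicate a true) _ _ ⟩
  replicate a true ++ replicate (m ∸ a) false ++ replicate (k * m) false   ≡⟨ cong (replicate a true ++_) (sym (replicate-+ (m ∸ a) (k * m) false)) ⟩
  replicate a true ++ replicate (m ∸ a + k * m) false                      ≡⟨ cong (λ z → replicate a true ++ replicate z false) (sym zeros) ⟩
  replicate a true ++ replicate b false                                    ∎)
  where
    a≤m : a ≤ m
    a≤m = <⇒≤ (≰⇒> m≰a)
    zeros : b ≡ m ∸ a + k * m
    zeros = +-cancelˡ-≡ a _ _ (trans e (trans (cong (_+ k * m) (sym (m+[n∸m]≡n a≤m))) (+-assoc a (m ∸ a) (k * m))))

blocksOfRuns : ∀ m rs → All (AlignedRun m) rs → ∃ λ xs → All (_≤ m) xs × blockWord m xs ≡ runsWord rs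
blocksOfRuns m [] _ = [] , [] , refl
blocksOfRuns m ((a , b) ∷ rs) ((_ , divides k e) ∷ aligned) with blocksOfRun m k (suc a) b e | blocksOfRuns m rs aligned
... | xs , xs≤m , ex | ys , ys≤m , ey =
  (xs ++ ys) , All-++⁺ xs≤m ys≤m , trans (blockWord-++ m xs ys) (cong₂ _++_ ex ey)

ones-rotL : ∀ k w → ones (rotL k w) ≡ ones w
ones-rotL zero w = refl
ones-rotL (suc k) [] = ones-rotL k []
ones-rotL (suc k) (b ∷ w) = trans (ones-rotL k (w ++ [ b ])) (trans (ones-++ w [ b ]) (ones-snoc b))
  where
    ones-snoc : ∀ b → ones w + ones [ b ] ≡ ones (b ∷ w)
    ones-snoc true = +-comm (ones w) 1
    ones-snoc false = +-identityʳ (ones w)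

Pointwise-sum : ∀ {u v} → Pointwise _≤_ u v → sum u ≤ sum v
Pointwise-sum [] = z≤n
Pointwise-sum (h ∷ hs) = +-mono-≤ h (Pointwise-sum hs)

Pointwise-sum-≡ : ∀ {u v} → Pointwise _≤_ u v → sum v ≤ sum u → u ≡ v
Pointwise-sum-≡ [] _ = refl
Pointwise-sum-≡ {a ∷ u} {b ∷ v} (a≤b ∷ hs) le = cong₂ _∷_ a≡b
  (Pointwise-sum-≡ hs (+-cancelˡ-≤ b (sum v) (sum u) (subst (λ z → b + sum v ≤ z + sum u) a≡b le)))
  where
    a≡b : a ≡ b
    a≡b = ≤-antisym a≤b (+-cancelʳ-≤ (sum v) b a (≤-trans le (+-monoʳ-≤ a (Pointwise-sum hs))))

-- Block words that are rotations of each other come from vectors that are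
-- rotations of each other: the shift lemma gives u ≤ a rotation of v, and
-- both have the same sum, namely the number of ones of the word.
blockWord-rotation : ∀ m → 1 ≤ m → ∀ u v t → length u ≡ length v → All (_≤ m) u → All (_≤ m) v →
  blockWord m u ≡ rotL t (blockWord m v) → ∃ λ q → u ≡ rotL q v
blockWord-rotation m m≥1 u v t le u≤m v≤m e with blockWord-shift m m≥1 u v t le u≤m (subst (blockWord m u ≼_) e ≼-refl)
... | q , u≤v = q , Pointwise-sum-≡ u≤v (≤-reflexive (begin
  sum (rotL q v)                  ≡⟨ sum-rotL q v ⟩
  sum v                           ≡⟨ sym (ones-blockWord m v≤m) ⟩
  ones (blockWord m v)            ≡⟨ sym (ones-rotL t (blockWord m v)) ⟩
  ones (rotL t (blockWord m v))   ≡⟨ cong ones (sym e) ⟩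
  ones (blockWord m u)            ≡⟨ ones-blockWord m u≤m ⟩
  sum u                           ∎))

rotL-cancel : {A : Set} (a b : ℕ) (u v : List A) → rotL a u ≡ rotL b v → ∃ λ c → u ≡ rotL c v
rotL-cancel a b u v e with rotL-undo a u
... | i , ei = b + i , (begin
  u                      ≡⟨ sym ei ⟩
  rotL i (rotL a u)      ≡⟨ cong (rotL i) e ⟩
  rotL i (rotL b v)      ≡⟨ sym (rotL-+ b i v) ⟩
  rotL (b + i) v         ∎)

-- A composition in 𝒬(N,m) that is not all ones is, up to rotation, the
-- block word of a vector with entries ≤ m: cut it into runs followed by t
-- ones, move the ones to the front of the first run (which aligns all runs,
-- since π is divisible by m) and read the runs as blocks.
blockWordOfDivisible : ∀ m bl → Positive bl → length bl < sum bl → DivisibleBy m (πN bl) →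
  ∃ λ xs → All (_≤ m) xs × ∃ λ t → blockWord m xs ≡ rotL t (compWord bl)
blockWordOfDivisible m bl pos short div with runDecomposition bl 0 pos
... | [] , t , _ , e = ⊥-elim (<-irrefl (begin
  length bl                 ≡⟨ cong length e ⟩
  length (replicate t 1)    ≡⟨ length-replicate t ⟩
  t                         ≡⟨ sym (sum-ones t) ⟩
  sum (replicate t 1)       ≡⟨ cong sum (sym e) ⟩
  sum bl                    ∎) short)
  where
    sum-ones : ∀ t → sum (replicate t 1) ≡ t
    sum-ones zero = refl
    sum-ones (suc t) = cong suc (sum-ones t)
... | (a , b) ∷ rs , t , tails , e with blocksOfRuns m ((t + a , b) ∷ rs)
                                          (divisible⇒aligned m a b rs t tails (subst (λ z → DivisibleBy m (πN z)) e div))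
...   | xs , xs≤m , ex = xs , xs≤m , t₁ , (begin
  blockWord m xs                          ≡⟨ ex ⟩
  runsWord ((t + a , b) ∷ rs)             ≡⟨ sym (compWord-runsComp ((t + a , b) ∷ rs)) ⟩
  compWord (runsComp ((t + a , b) ∷ rs))  ≡⟨ cong compWord (sym rotated) ⟩
  compWord (rotL L bl)                    ≡⟨ proj₂ (compWord-rotL L pos) ⟩
  rotL t₁ (compWord bl)                   ∎)
  where
    L = length (runsComp ((a , b) ∷ rs))
    t₁ = proj₁ (compWord-rotL L pos)
    rotated : rotL L bl ≡ runsComp ((t + a , b) ∷ rs)
    rotated = begin
      rotL L bl                                                       ≡⟨ cong (rotL L) e ⟩
      rotL L (runsComp ((a , b) ∷ rs) ++ replicate t 1)               ≡⟨ rotL-++ (runsComp ((a , b) ∷ rs)) _ ⟩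
      replicate t 1 ++ (replicate a 1 ++ [ suc b ]) ++ runsComp rs     ≡⟨ sym (++-assoc (replicate t 1) _ _) ⟩
      (replicate t 1 ++ replicate a 1 ++ [ suc b ]) ++ runsComp rs     ≡⟨ cong (_++ runsComp rs) (sym (++-assoc (replicate t 1) _ _)) ⟩
      ((replicate t 1 ++ replicate a 1) ++ [ suc b ]) ++ runsComp rs   ≡⟨ cong (λ z → (z ++ [ suc b ]) ++ runsComp rs) (sym (replicate-+ t a 1)) ⟩
      runsComp ((t + a , b) ∷ rs)                                     ∎

sum-positive : ∀ {xs} → Any (1 ≤_) xs → 1 ≤ sum xs
sum-positive {a ∷ xs} (here a≥1) = ≤-trans a≥1 (m≤m+n a (sum xs))
sum-positive {a ∷ xs} (there q) = ≤-trans (sum-positive q) (m≤n+m (sum xs) a)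

sum-bounded : ∀ {m xs} → All (_≤ m) xs → sum xs ≤ length xs * m
sum-bounded [] = z≤n
sum-bounded (a≤m ∷ as) = +-mono-≤ a≤m (sum-bounded as)

sum-below : ∀ {m xs} → All (_≤ m) xs → Any (_< m) xs → sum xs < length xs * m
sum-below (_ ∷ as) (here a<m) = +-mono-<-≤ a<m (sum-bounded as)
sum-below (a≤m ∷ as) (there q) = +-mono-≤-< a≤m (sum-below as q)

sum-constant : ∀ {c xs} → All (_≡ c) xs → sum xs ≡ length xs * c
sum-constant [] = refl
sum-constant (refl ∷ as) = cong (_ +_) (sum-constant as)

toList-rotV : ∀ {k} j (x : Vec ℕ k) → toList (rotV j x) ≡ rotL j (toList x)
toList-rotV zero x = refl
toList-rotV (suc j) V.[] = toList-rotV j V.[]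
toList-rotV (suc j) (a V.∷ xs) = trans (toList-rotV j (xs V.∷ʳ a)) (cong (rotL j) (VP.toList-∷ʳ a xs))

toList-inj : ∀ {k} (x y : Vec ℕ k) → toList x ≡ toList y → x ≡ y
toList-inj V.[] V.[] _ = refl
toList-inj (a V.∷ x) (b V.∷ y) e = cong₂ V._∷_ (proj₁ (∷-injective e)) (toList-inj x y (proj₂ (∷-injective e)))

vecOfList : ∀ {k} (xs : List ℕ) → length xs ≡ k → Σ (Vec ℕ k) λ v → toList v ≡ xs
vecOfList {zero} [] _ = V.[] , refl
vecOfList {suc k} (a ∷ xs) e with vecOfList {k} xs (cong pred e)
... | v , ev = (a V.∷ v) , cong (a ∷_) ev

sum-toList : ∀ {k} (x : Vec ℕ k) → V.sum x ≡ sum (toList x)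
sum-toList V.[] = refl
sum-toList (a V.∷ x) = cong (a +_) (sum-toList x)

Pointwise-toList⁺ : ∀ {k} {x y : Vec ℕ k} → VPW.Pointwise _≤_ x y → Pointwise _≤_ (toList x) (toList y)
Pointwise-toList⁺ VPW.[] = []
Pointwise-toList⁺ (h VPW.∷ hs) = h ∷ Pointwise-toList⁺ hs

Pointwise-toList⁻ : ∀ {k} (x y : Vec ℕ k) → Pointwise _≤_ (toList x) (toList y) → VPW.Pointwise _≤_ x y
Pointwise-toList⁻ V.[] V.[] [] = VPW.[]
Pointwise-toList⁻ (a V.∷ x) (b V.∷ y) (h ∷ hs) = h VPW.∷ Pointwise-toList⁻ x y hs

representative : ∀ n m (xs : List ℕ) → length xs ≡ n → All (_≤ m) xs → 1 ≤ sum xs → sum xs < n * m →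
  Σ (NRep n m) λ x → toList (proj₁ x) ≡ xs
representative n m xs len xs≤m pos below with vecOfList {n} xs len
... | v , refl = (v , toList⁻ xs≤m , nonzero , nonfull) , refl
  where
    nonzero : ¬ VAll.All (_≡ 0) v
    nonzero all0 with subst (1 ≤_) (trans (sum-constant (toList⁺ all0)) (*-zeroʳ (length (toList v)))) pos
    ... | ()
    nonfull : ¬ VAll.All (_≡ m) v
    nonfull allm = <-irrefl (trans (sum-constant (toList⁺ allm)) (cong (_* m) (VP.length-toList v))) below

module Construction (n m : ℕ) (n≥1 : 1 ≤ n) (m≥1 : 1 ≤ m) where

  entries : NRep n m → List ℕ
  entries x = toList (proj₁ x)

  entries≤m : ∀ x → All (_≤ m) (entries x)
  entries≤m x = toList⁺ (proj₁ (proj₂ x))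

  somePositive : ∀ x → Any (1 ≤_) (entries x)
  somePositive x@(_ , _ , nonzero , _) with any? (1 ≤?_) (entries x)
  ... | yes p = p
  ... | no ¬p = ⊥-elim (nonzero (toList⁻ (All.map (λ ¬v≥1 → n<1⇒n≡0 (≰⇒> ¬v≥1)) (¬Any⇒All¬ _ ¬p))))

  someBelow : ∀ x → Any (_< m) (entries x)
  someBelow x@(_ , _ , _ , nonfull) with any? (_<? m) (entries x)
  ... | yes p = p
  ... | no ¬p = ⊥-elim (nonfull (toList⁻
    (All.zipWith (λ (v≤m , ¬v<m) → ≤-antisym v≤m (≮⇒≥ ¬v<m)) (entries≤m x , ¬Any⇒All¬ _ ¬p))))

  goodRot : ∀ x → ∃ λ k → Good m (rotL k (entries x))
  goodRot x = goodRotation m m≥1 (entries x) (somePositive x) (someBelow x)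

  shift : NRep n m → ℕ
  shift x = proj₁ (goodRot x)

  normalized : NRep n m → List ℕ
  normalized x = rotL (shift x) (entries x)

  normalized≤m : ∀ x → All (_≤ m) (normalized x)
  normalized≤m x = All-rotL (shift x) (entries≤m x)

  length-normalized : ∀ x → length (normalized x) ≡ n
  length-normalized x = trans (length-rotL (shift x) (entries x)) (VP.length-toList (proj₁ x))

  runsOf : ∀ x → ∃ λ rs → All (AlignedRun m) rs × runsWord rs ≡ blockWord m (normalized x)
  runsOf x = runsOfGood m m≥1 (normalized x) (normalized≤m x) (proj₂ (goodRot x))

  composition : NRep n m → List ℕ
  composition x = runsComp (proj₁ (runsOf x))

  composition-positive : ∀ x → Positive (composition x)
  composition-positive x = Positive-runsComp (proj₁ (runsOf x))

  compWord-composition : ∀ x → compWord (composition x) ≡ blockWord m (normalized x)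
  compWord-composition x = trans (compWord-runsComp (proj₁ (runsOf x))) (proj₂ (proj₂ (runsOf x)))

  compWord-composition-headOne : ∀ x → ∃ λ s → compWord (composition x) ≡ true ∷ s
  compWord-composition-headOne x with blockWord-headOne m m≥1 (normalized x) (proj₁ (proj₂ (goodRot x)))
  ... | s , e = s , trans (compWord-composition x) e

  length-composition : ∀ x → length (composition x) ≡ V.sum (proj₁ x)
  length-composition x = begin
    length (composition x)               ≡⟨ sym (ones-compWord (composition-positive x)) ⟩
    ones (compWord (composition x))      ≡⟨ cong ones (compWord-composition x) ⟩
    ones (blockWord m (normalized x))    ≡⟨ ones-blockWord m (normalized≤m x) ⟩
    sum (normalized x)                   ≡⟨ sum-rotL (shift x) (entries x) ⟩
    sum (entries x)                      ≡⟨ sym (sum-toList (proj₁ x)) ⟩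
    V.sum (proj₁ x)                      ∎

  sum-composition : ∀ x → sum (composition x) ≡ m * n
  sum-composition x = begin
    sum (composition x)                     ≡⟨ sym (length-compWord (composition-positive x)) ⟩
    length (compWord (composition x))       ≡⟨ cong length (compWord-composition x) ⟩
    length (blockWord m (normalized x))     ≡⟨ length-blockWord m (normalized x) ⟩
    length (normalized x) * m               ≡⟨ cong (_* m) (length-normalized x) ⟩
    n * m                                   ≡⟨ *-comm n m ⟩
    m * n                                   ∎

  -- 1 ≤ Σxᵢ ≤ mn - 1, as x is neither constantly 0 nor constantly m.
  composition-nonempty : ∀ x → 1 ≤ length (composition x)
  composition-nonempty x = subst (1 ≤_) (sym (trans (length-composition x) (sum-toList (proj₁ x))))
    (sum-positive (somePositive x))

  composition-short : ∀ x → length (composition x) ≤ m * n ∸ 1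
  composition-short x = <⇒≤pred (subst₂ _<_ (sym (trans (length-composition x) (sum-toList (proj₁ x))))
    (trans (cong (_* m) (VP.length-toList (proj₁ x))) (*-comm n m))
    (sum-below (entries≤m x) (someBelow x)))

  -- ψ(x) ∈ 𝒬(mn,m): its runs are aligned, so π(ψ(x)) is divisible by m.
  ψ : NRep n m → QRep (m * n) m
  ψ x = composition x , (composition-positive x , sum-composition x , composition-nonempty x , composition-short x) ,
        runsComp-divisible m (proj₁ (runsOf x)) (proj₁ (proj₂ (runsOf x)))

  blockWord-rotL-entries : ∀ x k → ∃ λ t → blockWord m (rotL k (entries x)) ≡ rotL t (compWord (composition x))
  blockWord-rotL-entries x k with rotL-undo (shift x) (entries x)
  ... | i , ei = (i + k) * m , (begin
    blockWord m (rotL k (entries x))                 ≡⟨ cong (λ z → blockWord m (rotL k z)) (sym ei) ⟩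
    blockWord m (rotL k (rotL i (normalized x)))     ≡⟨ cong (blockWord m) (sym (rotL-+ i k _)) ⟩
    blockWord m (rotL (i + k) (normalized x))        ≡⟨ blockWord-rotL m (i + k) _ ⟩
    rotL ((i + k) * m) (blockWord m (normalized x))  ≡⟨ cong (rotL ((i + k) * m)) (sym (compWord-composition x)) ⟩
    rotL ((i + k) * m) (compWord (composition x))    ∎)

  rotatedComposition : ∀ x k s → blockWord m (rotL k (entries x)) ≡ true ∷ s →
    ∃ λ k' → blockWord m (rotL k (entries x)) ≡ compWord (rotL k' (composition x))
  rotatedComposition x k s e with blockWord-rotL-entries x k
  ... | t , et with compWord-rotL-atOne t (composition-positive x) s (trans (sym et) e)
  ...   | k' , ek' = k' , trans et ek'

  ∼N⇒entries : ∀ x y → x ∼N y → ∃ λ k → entries y ≡ rotL k (entries x)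
  ∼N⇒entries x y (k , e) = k , trans (cong toList (sym e)) (toList-rotV k (proj₁ x))

  entries⇒∼N : ∀ x y k → entries y ≡ rotL k (entries x) → x ∼N y
  entries⇒∼N x y k e = k , toList-inj (rotV k (proj₁ x)) (proj₁ y) (trans (toList-rotV k (proj₁ x)) (sym e))

  ≤N⇒entries : ∀ x y → x ≤N y → ∃ λ k → ∃ λ l → Pointwise _≤_ (rotL k (entries x)) (rotL l (entries y))
  ≤N⇒entries x y (k , l , x≤y) =
    k , l , subst₂ (Pointwise _≤_) (toList-rotV k (proj₁ x)) (toList-rotV l (proj₁ y)) (Pointwise-toList⁺ x≤y)

  entries⇒≤N : ∀ x y k l → Pointwise _≤_ (rotL k (entries x)) (rotL l (entries y)) → x ≤N y
  entries⇒≤N x y k l x≤y = k , l , Pointwise-toList⁻ (rotV k (proj₁ x)) (rotV l (proj₁ y))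
    (subst₂ (Pointwise _≤_) (sym (toList-rotV k (proj₁ x))) (sym (toList-rotV l (proj₁ y))) x≤y)

  compWord-composition-rotated : ∀ x y k → entries y ≡ rotL k (entries x) →
    compWord (composition y) ≡ blockWord m (rotL (k + shift y) (entries x))
  compWord-composition-rotated x y k ey = trans (compWord-composition y) (cong (blockWord m)
    (trans (cong (rotL (shift y)) ey) (sym (rotL-+ k (shift y) (entries x)))))

  -- Rotating x rotates ψ(x): the word of ψ(y) starts with a one, so it is the
  -- word of a rotation of ψ(x), and compositions are determined by words.
  ψ-wellDefined : ∀ x y → x ∼N y → ψ x ∼Q ψ y
  ψ-wellDefined x y x∼y with ∼N⇒entries x y x∼y | compWord-composition-headOne y
  ... | k , ey | s , es with rotatedComposition x (k + shift y) s
                               (trans (sym (compWord-composition-rotated x y k ey)) es)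
  ...   | k' , ek' = k' , compWord-injective (All-rotL k' (composition-positive x)) (composition-positive y)
                        (trans (sym ek') (sym (compWord-composition-rotated x y k ey)))

  -- If ψ(x) and ψ(y) are rotations of each other, so are their words, hence
  -- so are the normalized vectors (blockWord-rotation), hence x and y.
  ψ-injective : ∀ x y → ψ x ∼Q ψ y → x ∼N y
  ψ-injective x y (k , e) with compWord-rotL k (composition-positive x)
  ... | t , et with blockWord-rotation m m≥1 (normalized y) (normalized x) t
                      (trans (length-normalized y) (sym (length-normalized x))) (normalized≤m y) (normalized≤m x) words
    where
      words : blockWord m (normalized y) ≡ rotL t (blockWord m (normalized x))
      words = begin
        blockWord m (normalized y)              ≡⟨ sym (compWord-composition y) ⟩
        compWord (composition y)                ≡⟨ cong compWord (sym e) ⟩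
        compWord (rotL k (composition x))       ≡⟨ et ⟩
        rotL t (compWord (composition x))       ≡⟨ cong (rotL t) (compWord-composition x) ⟩
        rotL t (blockWord m (normalized x))     ∎
  ... | q , eq with rotL-cancel (shift y) (shift x + q) (entries y) (entries x)
                      (trans eq (sym (rotL-+ (shift x) q (entries x))))
  ... | c , ec = entries⇒∼N x y c ec

  -- Every element of 𝒬(mn,m) is, up to rotation, ψ of some x: the vector
  -- whose block word is a rotation of its composition word.
  vectorOf : ∀ (b : QRep (m * n) m) → Σ (NRep n m) λ x → ∃ λ t → blockWord m (entries x) ≡ rotL t (compWord (proj₁ b))
  vectorOf (bl , (pos , sum≡ , nonempty , short) , div) =
    fromWord (blockWordOfDivisible m bl pos (subst (length bl <_) (sym sum≡) short') div)
    where
      short' : length bl < m * n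
      short' = m≤pred[n]⇒suc[m]≤n {{>-nonZero (*-mono-≤ m≥1 n≥1)}} short
      fromWord : (∃ λ xs → All (_≤ m) xs × ∃ λ t → blockWord m xs ≡ rotL t (compWord bl)) →
        Σ (NRep n m) λ x → ∃ λ t → blockWord m (entries x) ≡ rotL t (compWord bl)
      fromWord (xs , xs≤m , t , ext) with representative n m xs length-xs xs≤m
                                            (subst (1 ≤_) (sym sum-xs) nonempty) (subst₂ _<_ (sym sum-xs) (*-comm m n) short')
        where
          length-xs : length xs ≡ n
          length-xs = *-cancelʳ-≡ (length xs) n m {{>-nonZero m≥1}} (begin
            length xs * m                   ≡⟨ sym (length-blockWord m xs) ⟩
            length (blockWord m xs)         ≡⟨ cong length ext ⟩
            length (rotL t (compWord bl))   ≡⟨ length-rotL t (compWord bl) ⟩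
            length (compWord bl)            ≡⟨ length-compWord pos ⟩
            sum bl                          ≡⟨ sum≡ ⟩
            m * n                           ≡⟨ *-comm m n ⟩
            n * m                           ∎)
          sum-xs : sum xs ≡ length bl
          sum-xs = begin
            sum xs                          ≡⟨ sym (ones-blockWord m xs≤m) ⟩
            ones (blockWord m xs)           ≡⟨ cong ones ext ⟩
            ones (rotL t (compWord bl))     ≡⟨ ones-rotL t (compWord bl) ⟩
            ones (compWord bl)              ≡⟨ ones-compWord pos ⟩
            length bl                       ∎
      ... | x , ex = x , t , trans (cong (blockWord m) ex) ext

  -- So every b is a rotation of ψ(x): the word of ψ(x) is a rotation of the
  -- word of b and starts with a one.
  ψ-surjective : ∀ b → ∃ λ x → ψ x ∼Q b
  ψ-surjective b@(bl , (pos , _) , _) with vectorOf b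
  ... | x , t , ext with rotation-fromWord bl (composition x) pos (composition-positive x)
                           (t + shift x * m) word (compWord-composition-headOne x)
    where
      word : compWord (composition x) ≡ rotL (t + shift x * m) (compWord bl)
      word = begin
        compWord (composition x)                                ≡⟨ compWord-composition x ⟩
        blockWord m (rotL (shift x) (entries x))      ≡⟨ blockWord-rotL m (shift x) (entries x) ⟩
        rotL (shift x * m) (blockWord m (entries x))  ≡⟨ cong (rotL (shift x * m)) ext ⟩
        rotL (shift x * m) (rotL t (compWord bl))     ≡⟨ sym (rotL-+ t (shift x * m) (compWord bl)) ⟩
        rotL (t + shift x * m) (compWord bl)          ∎
  ... | k , ek = x , rotL-sym k bl (composition x) ek

  -- Order: a componentwise comparison of rotations of x and y, rotated
  -- further so that x becomes good, compares the block words, which are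
  -- then words of rotations of ψ(x) and ψ(y).
  ψ-monotone : ∀ x y → x ≤N y → ψ x ≤Q ψ y
  ψ-monotone x y x≤y with ≤N⇒entries x y x≤y
  ... | k , l , pw with goodRotation m m≥1 (rotL k (entries x)) (Any-rotL k (somePositive x)) (Any-rotL k (someBelow x))
  ... | p , (head , _) with blockWord-headOne m m≥1 _ head
  ... | s , es = refinement
    where
      startX : blockWord m (rotL (k + p) (entries x)) ≡ true ∷ s
      startX = trans (cong (blockWord m) (rotL-+ k p (entries x))) es
      words≼ : blockWord m (rotL (k + p) (entries x)) ≼ blockWord m (rotL (l + p) (entries y))
      words≼ = subst₂ _≼_ (cong (blockWord m) (sym (rotL-+ k p (entries x)))) (cong (blockWord m) (sym (rotL-+ l p (entries y))))
                 (blockWord-mono m (Pointwise-rotL p pw))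
      startsWithOne : ∀ {s w} → true ∷ s ≼ w → ∃ λ s' → w ≡ true ∷ s'
      startsWithOne (b≤b ∷ _) = _ , refl
      refinement : ψ x ≤Q ψ y
      refinement with rotatedComposition x (k + p) s startX | startsWithOne (subst (_≼ _) startX words≼)
      ... | k' , ek' | s' , es' with rotatedComposition y (l + p) s' es'
      ... | l' , el' = k' , l' , compWord≼⇒refines (All-rotL k' (composition-positive x)) (All-rotL l' (composition-positive y))
                         (subst₂ _≼_ ek' el' words≼)

  -- Conversely a refinement compares rotations of the words, hence the
  -- block word of normalized x with a rotation of that of normalized y,
  -- and the shift lemma compares the vectors.
  ψ-reflecting : ∀ x y → ψ x ≤Q ψ y → x ≤N y
  ψ-reflecting x y (k , l , ref) with compWord-rotL k (composition-positive x) | compWord-rotL l (composition-positive y)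
  ... | t₁ , e₁ | t₂ , e₂ with rotL-undo t₁ (blockWord m (normalized x))
  ... | i , eᵢ with blockWord-shift m m≥1 (normalized x) (normalized y) (t₂ + i)
                      (trans (length-normalized x) (sym (length-normalized y))) (normalized≤m x) words≼
    where
      rotated≼ : rotL t₁ (blockWord m (normalized x)) ≼ rotL t₂ (blockWord m (normalized y))
      rotated≼ = subst₂ _≼_ (trans e₁ (cong (rotL t₁) (compWord-composition x))) (trans e₂ (cong (rotL t₂) (compWord-composition y)))
                   (refines⇒compWord≼ ref (All-rotL l (composition-positive y)))
      words≼ : blockWord m (normalized x) ≼ rotL (t₂ + i) (blockWord m (normalized y))
      words≼ = subst₂ _≼_ eᵢ (sym (rotL-+ t₂ i _)) (Pointwise-rotL i rotated≼)
  ... | q , x≤y = entries⇒≤N x y (shift x) (shift y + q)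
                    (subst (Pointwise _≤_ (normalized x)) (sym (rotL-+ (shift y) q (entries y))) x≤y)

lemma3p2 : (n m : ℕ) → 1 ≤ n → 1 ≤ m →
    Σ (NRep n m → QRep (m * n) m) IsRankedIso
lemma3p2 n m n≥1 m≥1 = ψ , record
  { wellDefined = ψ-wellDefined
  ; injective   = ψ-injective
  ; surjective  = ψ-surjective
  ; orderIso    = λ x y → mk⇔ (ψ-monotone x y) (ψ-reflecting x y)
  ; rankPres    = length-composition
  }
  where open Construction n m n≥1 m≥1
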